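{- Let $F$ be a graph with $m$ edges. Let $0 \leq k \leq |V(F)|$, and let $A$ be a set of $k$ highest-degree vertices of $F$ (i.e. every vertex in $A$ has degree in $F$ at least that of every vertex outside $A$). Let $G$ be a graph with $N$ vertices and average degree $d$. Let $\sigma' : A \to V(G)$ be an embedding of $F[A]$ into $\overline{G}$. Suppose that $$N \geq \frac{4m}{k+1} \cdot \max\Big( \max_{v \in \sigma'(A)} d_G(v),\; 2d \Big) + 2|V(F)|.$$ Then there is an embedding $\sigma$ of $F$ into $\overline{G}$ which extends $\sigma'$ (i.e. $\sigma(x) = \sigma'(x)$ for all $x \in A$).
   Context: An embedding of a graph $F$ into a graph $\overline{G}$ is an injective map $V(F) \to V(G)$ sending edges of $F$ to edges of $\overline{G}$, i.e. to non-adjacent pairs in $G$. $\overline{G}$ is the complement of $G$, $F[A]$ is the subgraph of $F$ induced on $A$, and $d_G(v)$ is the degree of $v$ in $G$. -}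

module Defs where

open import Data.Nat using (ℕ; zero; suc; _+_; _*_; _⊔_; _<ᵇ_; NonZero)
open import Data.Bool using (Bool; true; false; if_then_else_; _∧_)
open import Data.Fin using (Fin; zero; suc; toℕ)
open import Data.Fin.Subset using (Subset)
open import Data.Vec using (lookup)
open import Data.Integer using (+_)
open import Data.Rational using (ℚ; _/_)
open import Function using (_∘_)
open import Relation.Binary.PropositionalEquality using (_≡_)

record Graph : Set where
  field
    size   : ℕ
    adj    : Fin size → Fin size → Bool
    sym    : ∀ i j → adj i j ≡ adj j i
    irrefl : ∀ i → adj i i ≡ false
open Graph public

V : Graph → Set
V G = Fin (size G)

countTrue : ∀ {n} → (Fin n → Bool) → ℕ
countTrue {zero}  f = 0
countTrue {suc n} f = (if f zero then 1 else 0) + countTrue (f ∘ suc)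

sumFin : ∀ {n} → (Fin n → ℕ) → ℕ
sumFin {zero}  f = 0
sumFin {suc n} f = f zero + sumFin (f ∘ suc)

maxFin : ∀ {n} → (Fin n → ℕ) → ℕ
maxFin {zero}  f = 0
maxFin {suc n} f = f zero ⊔ maxFin (f ∘ suc)

degree : (G : Graph) → V G → ℕ
degree G v = countTrue (adj G v)

edgeCount : Graph → ℕ
edgeCount G = sumFin (λ i → countTrue (λ j → (toℕ i <ᵇ toℕ j) ∧ adj G i j))

_∈ᵇ_ : ∀ {n} → Fin n → Subset n → Bool
x ∈ᵇ A = lookup A x

ℕ→ℚ : ℕ → ℚ
ℕ→ℚ n = + n / 1

avgDegree : (G : Graph) → .{{_ : NonZero (size G)}} → ℚ
avgDegree G = + (2 * edgeCount G) / size G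

-- σ restricted to A is an embedding of F[A] into the complement of G:
-- injective on A, and edges of F[A] go to non-edges of G
EmbedsOn : (F G : Graph) → (V F → Bool) → (V F → V G) → Set
EmbedsOn F G inA σ =
  (∀ x y → inA x ≡ true → inA y ≡ true → σ x ≡ σ y → x ≡ y) ×'
  (∀ x y → inA x ≡ true → inA y ≡ true → adj F x y ≡ true → adj G (σ x) (σ y) ≡ false)
  where open import Data.Product using () renaming (_×_ to _×'_)

Embedding : (F G : Graph) → (V F → V G) → Set
Embedding F G σ = EmbedsOn F G (λ _ → true) σ

-- Embed the vertices outside A greedily, in turn, into vertices of G of degree at most
-- D = max(Δ, ⌊4e/N⌋), where Δ bounds the degrees of σ'(A) and e = |E(G)|. By Markov's inequality
-- more than N/2 vertices of G have degree at most 4e/N, hence at most D. A vertex y ∉ A of degree t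
-- satisfies (k+1)t ≤ 2m, since y and the k vertices of A all have degree at least t. The vertices
-- embedded so far rule out at most n + tD of the candidates for y: their images, and the at most D
-- neighbours of the image of each neighbour of y. The hypothesis on N gives 2(n + tD) ≤ N, so a
-- candidate is left.

module Submission where

open import Defs hiding (sym)
open import Data.Nat using (ℕ)

module FiniteSums where

  open import Algebra.Properties.CommutativeSemigroup using (interchange)
  open import Data.Bool using (Bool; true; false; if_then_else_; _∧_; _∨_; not)
  open import Data.Bool.Properties using (∧-conicalˡ; ∧-conicalʳ; not-injective)
  open import Data.Fin using (Fin; zero; suc; _≟_)
  open import Data.Nat using (ℕ; zero; suc; _+_; _*_; _≤_; _<_; z≤n; s≤s)
  open import Data.Nat.Properties hiding (_≟_)
  open import Data.Product using (Σ; _×_; _,_)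
  open import Function using (_∘_)
  open import Relation.Binary.PropositionalEquality
  open import Relation.Nullary using (does; contradiction)

  private variable
    m n : ℕ

  indicator : Bool → ℕ
  indicator b = if b then 1 else 0

  sumFin-cong : {f g : Fin n → ℕ} → (∀ i → f i ≡ g i) → sumFin f ≡ sumFin g
  sumFin-cong {zero}  f≗g = refl
  sumFin-cong {suc n} f≗g = cong₂ _+_ (f≗g zero) (sumFin-cong (f≗g ∘ suc))

  sumFin-mono-≤ : {f g : Fin n → ℕ} → (∀ i → f i ≤ g i) → sumFin f ≤ sumFin g
  sumFin-mono-≤ {zero}  f≤g = z≤n
  sumFin-mono-≤ {suc n} f≤g = +-mono-≤ (f≤g zero) (sumFin-mono-≤ (f≤g ∘ suc))

  sumFin-const : ∀ c → sumFin {n} (λ _ → c) ≡ n * c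
  sumFin-const {zero}  c = refl
  sumFin-const {suc n} c = cong (c +_) (sumFin-const {n} c)

  sumFin-+ : (f g : Fin n → ℕ) → sumFin (λ i → f i + g i) ≡ sumFin f + sumFin g
  sumFin-+ {zero}  f g = refl
  sumFin-+ {suc n} f g = begin
    f zero + g zero + sumFin (λ i → f (suc i) + g (suc i))
      ≡⟨ cong (f zero + g zero +_) (sumFin-+ (f ∘ suc) (g ∘ suc)) ⟩
    f zero + g zero + (sumFin (f ∘ suc) + sumFin (g ∘ suc))
      ≡⟨ interchange +-commutativeSemigroup (f zero) (g zero) _ _ ⟩
    f zero + sumFin (f ∘ suc) + (g zero + sumFin (g ∘ suc)) ∎
    where open ≡-Reasoning

  sumFin-*ʳ : (f : Fin n → ℕ) (c : ℕ) → sumFin (λ i → f i * c) ≡ sumFin f * c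
  sumFin-*ʳ {zero}  f c = refl
  sumFin-*ʳ {suc n} f c = trans (cong (f zero * c +_) (sumFin-*ʳ (f ∘ suc) c))
                                (sym (*-distribʳ-+ c (f zero) (sumFin (f ∘ suc))))

  sumFin-swap : (f : Fin m → Fin n → ℕ) →
                sumFin (λ i → sumFin (f i)) ≡ sumFin (λ j → sumFin (λ i → f i j))
  sumFin-swap {zero}  {n} f = trans (sym (*-zeroʳ n)) (sym (sumFin-const {n} 0))
  sumFin-swap {suc m}     f = begin
    sumFin (f zero) + sumFin (λ i → sumFin (f (suc i)))
      ≡⟨ cong (sumFin (f zero) +_) (sumFin-swap (f ∘ suc)) ⟩
    sumFin (f zero) + sumFin (λ j → sumFin (λ i → f (suc i) j))
      ≡⟨ sumFin-+ (f zero) (λ j → sumFin (λ i → f (suc i) j)) ⟨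
    sumFin (λ j → f zero j + sumFin (λ i → f (suc i) j)) ∎
    where open ≡-Reasoning

  countTrue≡sumFin : (f : Fin n → Bool) → countTrue f ≡ sumFin (indicator ∘ f)
  countTrue≡sumFin {zero}  f = refl
  countTrue≡sumFin {suc n} f = cong (indicator (f zero) +_) (countTrue≡sumFin (f ∘ suc))

  countTrue-false : countTrue {n} (λ _ → false) ≡ 0
  countTrue-false {zero}  = refl
  countTrue-false {suc n} = countTrue-false {n}

  countTrue-≟ : (i : Fin n) → countTrue (λ j → does (i ≟ j)) ≡ 1
  countTrue-≟ {suc n} zero    = cong suc (countTrue-false {n})
  countTrue-≟ {suc n} (suc i) = countTrue-≟ i

  countTrue-not : (f : Fin n → Bool) → countTrue f + countTrue (not ∘ f) ≡ n
  countTrue-not {zero}  f = refl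
  countTrue-not {suc n} f with f zero
  ... | true  = cong suc (countTrue-not (f ∘ suc))
  ... | false = trans (+-suc (countTrue (f ∘ suc)) _) (cong suc (countTrue-not (f ∘ suc)))

  countTrue-mono : {f g : Fin n → Bool} → (∀ i → f i ≡ true → g i ≡ true) → countTrue f ≤ countTrue g
  countTrue-mono {zero}          f⇒g = z≤n
  countTrue-mono {suc n} {f} {g} f⇒g with f zero in f₀ | g zero in g₀
  ... | false | b     = ≤-trans (countTrue-mono (f⇒g ∘ suc)) (m≤n+m _ (indicator b))
  ... | true  | true  = s≤s (countTrue-mono (f⇒g ∘ suc))
  ... | true  | false = contradiction (trans (sym g₀) (f⇒g zero f₀)) λ ()

  countTrue-≤-+ : (f g h : Fin n → Bool) →
                  (∀ i → indicator (f i) ≤ indicator (g i) + indicator (h i)) →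
                  countTrue f ≤ countTrue g + countTrue h
  countTrue-≤-+ {zero}  f g h le = z≤n
  countTrue-≤-+ {suc n} f g h le = begin
    indicator (f zero) + countTrue (f ∘ suc)
      ≤⟨ +-mono-≤ (le zero) (countTrue-≤-+ (f ∘ suc) (g ∘ suc) (h ∘ suc) (le ∘ suc)) ⟩
    indicator (g zero) + indicator (h zero) + (countTrue (g ∘ suc) + countTrue (h ∘ suc))
      ≡⟨ interchange +-commutativeSemigroup (indicator (g zero)) _ _ _ ⟩
    countTrue g + countTrue h ∎
    where open ≤-Reasoning

  countTrue-∨ : (f g : Fin n → Bool) → countTrue (λ i → f i ∨ g i) ≤ countTrue f + countTrue g
  countTrue-∨ f g = countTrue-≤-+ _ f g (λ i → bound (f i) (g i))
    where
    bound : ∀ a b → indicator (a ∨ b) ≤ indicator a + indicator b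
    bound true  b = s≤s z≤n
    bound false b = ≤-refl

  countTrue-∨-disjoint : (f g : Fin n → Bool) → (∀ i → f i ≡ true → g i ≡ false) →
                         countTrue (λ i → f i ∨ g i) ≡ countTrue f + countTrue g
  countTrue-∨-disjoint {zero}  f g disjoint = refl
  countTrue-∨-disjoint {suc n} f g disjoint with f zero in f₀ | g zero in g₀
  ... | true  | true  = contradiction (trans (sym g₀) (disjoint zero f₀)) λ ()
  ... | true  | false = cong suc (countTrue-∨-disjoint (f ∘ suc) (g ∘ suc) (disjoint ∘ suc))
  ... | false | true  = trans (cong suc (countTrue-∨-disjoint (f ∘ suc) (g ∘ suc) (disjoint ∘ suc)))
                             (sym (+-suc (countTrue (f ∘ suc)) _))
  ... | false | false = countTrue-∨-disjoint (f ∘ suc) (g ∘ suc) (disjoint ∘ suc)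

  countTrue*≤sumFin : (f : Fin n → Bool) (w : Fin n → ℕ) (c : ℕ) →
                      (∀ i → f i ≡ true → c ≤ w i) → countTrue f * c ≤ sumFin w
  countTrue*≤sumFin {zero}  f w c heavy = z≤n
  countTrue*≤sumFin {suc n} f w c heavy with f zero in f₀
  ... | true  = +-mono-≤ (heavy zero f₀) (countTrue*≤sumFin (f ∘ suc) (w ∘ suc) c (heavy ∘ suc))
  ... | false = ≤-trans (countTrue*≤sumFin (f ∘ suc) (w ∘ suc) c (heavy ∘ suc)) (m≤n+m _ (w zero))

  countTrue>0⇒∃ : (f : Fin n → Bool) → 0 < countTrue f → Σ (Fin n) λ i → f i ≡ true
  countTrue>0⇒∃ {suc n} f pos with f zero in f₀
  ... | true  = zero , f₀
  ... | false with countTrue>0⇒∃ (f ∘ suc) pos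
  ...   | i , fi = suc i , fi

  ∃-avoiding : (f : Fin m → Bool) (P : Fin n → Fin m → Bool) →
               sumFin (λ x → countTrue (P x)) < countTrue f →
               Σ (Fin m) λ c → f c ≡ true × (∀ x → P x c ≡ false)
  ∃-avoiding {n = zero}  f P small with countTrue>0⇒∃ f small
  ... | c , fc = c , fc , λ ()
  ∃-avoiding {n = suc n} f P small with ∃-avoiding (λ c → f c ∧ not (P zero c)) (P ∘ suc) small′
    where
    small′ : sumFin (λ x → countTrue (P (suc x))) < countTrue (λ c → f c ∧ not (P zero c))
    small′ = +-cancelˡ-< (countTrue (P zero)) _ _ (begin-strict
      countTrue (P zero) + sumFin (λ x → countTrue (P (suc x)))
        <⟨ small ⟩
      countTrue f
        ≤⟨ countTrue-≤-+ f _ (P zero) (λ c → split (f c) (P zero c)) ⟩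
      countTrue (λ c → f c ∧ not (P zero c)) + countTrue (P zero)
        ≡⟨ +-comm _ (countTrue (P zero)) ⟩
      countTrue (P zero) + countTrue (λ c → f c ∧ not (P zero c)) ∎)
      where
      open ≤-Reasoning
      split : ∀ a b → indicator a ≤ indicator (a ∧ not b) + indicator b
      split false b     = z≤n
      split true  false = s≤s z≤n
      split true  true  = s≤s z≤n
  ... | c , fc′ , avoided = c , ∧-conicalˡ _ _ fc′ , avoided′
    where
    avoided′ : ∀ x → P x c ≡ false
    avoided′ zero    = not-injective (∧-conicalʳ (f c) _ fc′)
    avoided′ (suc x) = avoided x

  f≤maxFin : (f : Fin n → ℕ) (i : Fin n) → f i ≤ maxFin f
  f≤maxFin f zero    = m≤m⊔n _ _
  f≤maxFin f (suc i) = ≤-trans (f≤maxFin (f ∘ suc) i) (m≤n⊔m _ _)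

module Degrees where

  open FiniteSums
  open import Data.Bool using (Bool; true; false; _∧_; _∨_; not)
  open import Data.Bool.Properties using (T-≡)
  open import Function.Bundles using (Equivalence)
  open import Data.Fin using (toℕ; _≟_)
  open import Data.Fin.Properties using (toℕ-injective)
  open import Data.Fin.Subset using (Subset; ∣_∣)
  open import Data.Nat using (ℕ; suc; _+_; _*_; _/_; _≤_; _<_; _<ᵇ_; _≤ᵇ_; NonZero; ≢-nonZero⁻¹)
  open import Data.Nat.DivMod using (m*n/n≡m; /-monoˡ-≤)
  open import Data.Nat.Properties hiding (_≟_)
  open import Data.Nat.Tactic.RingSolver using (solve-∀)
  open import Data.Vec using ([]; _∷_)
  open import Function using (_∘_)
  open import Relation.Binary.PropositionalEquality
  open import Relation.Nullary using (does; yes; no; contradiction)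
  open import Relation.Nullary.Reflects using (ofʸ; ofⁿ)

  ordered : (G : Graph) → V G → V G → ℕ
  ordered G i j = indicator ((toℕ i <ᵇ toℕ j) ∧ adj G i j)

  adjacency-split : (G : Graph) (i j : V G) → indicator (adj G i j) ≡ ordered G i j + ordered G j i
  adjacency-split G i j
    with toℕ i <ᵇ toℕ j | <ᵇ-reflects-< (toℕ i) (toℕ j) | toℕ j <ᵇ toℕ i | <ᵇ-reflects-< (toℕ j) (toℕ i)
  ... | true  | ofʸ i<j | true  | ofʸ j<i = contradiction j<i (<-asym i<j)
  ... | true  | _       | false | _       = sym (+-identityʳ _)
  ... | false | _       | true  | _       = cong indicator (Graph.sym G i j)
  ... | false | ofⁿ i≮j | false | ofⁿ j≮i with toℕ-injective (≤-antisym (≮⇒≥ j≮i) (≮⇒≥ i≮j))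
  ...   | refl = cong indicator (irrefl G i)

  sumFin-degree : (G : Graph) → sumFin (degree G) ≡ 2 * edgeCount G
  sumFin-degree G = begin
    sumFin (degree G)
      ≡⟨ sumFin-cong (λ i → countTrue≡sumFin (adj G i)) ⟩
    sumFin (λ i → sumFin (λ j → indicator (adj G i j)))
      ≡⟨ sumFin-cong (λ i → sumFin-cong (adjacency-split G i)) ⟩
    sumFin (λ i → sumFin (λ j → ordered G i j + ordered G j i))
      ≡⟨ sumFin-cong (λ i → sumFin-+ (ordered G i) (λ j → ordered G j i)) ⟩
    sumFin (λ i → sumFin (ordered G i) + sumFin (λ j → ordered G j i))
      ≡⟨ sumFin-+ (λ i → sumFin (ordered G i)) (λ i → sumFin (λ j → ordered G j i)) ⟩
    sumFin (λ i → sumFin (ordered G i)) + sumFin (λ i → sumFin (λ j → ordered G j i))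
      ≡⟨ cong (sumFin (λ i → sumFin (ordered G i)) +_) (sumFin-swap (λ i j → ordered G j i)) ⟩
    sumFin (λ i → sumFin (ordered G i)) + sumFin (λ i → sumFin (ordered G i))
      ≡⟨ cong₂ _+_ edges edges ⟨
    edgeCount G + edgeCount G
      ≡⟨ cong (edgeCount G +_) (+-identityʳ (edgeCount G)) ⟨
    2 * edgeCount G ∎
    where
    open ≡-Reasoning
    edges : edgeCount G ≡ sumFin (λ i → sumFin (ordered G i))
    edges = sumFin-cong (λ i → countTrue≡sumFin (λ j → (toℕ i <ᵇ toℕ j) ∧ adj G i j))

  ∣A∣≡countTrue : ∀ {n} (A : Subset n) → ∣ A ∣ ≡ countTrue (_∈ᵇ A)
  ∣A∣≡countTrue []          = refl
  ∣A∣≡countTrue (true ∷ A)  = cong suc (∣A∣≡countTrue A)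
  ∣A∣≡countTrue (false ∷ A) = ∣A∣≡countTrue A

  degree-below-top : (F : Graph) (A : Subset (size F)) (y : V F) → y ∈ᵇ A ≡ false →
                     (∀ x → x ∈ᵇ A ≡ true → degree F y ≤ degree F x) →
                     suc ∣ A ∣ * degree F y ≤ 2 * edgeCount F
  degree-below-top F A y y∉A top = begin
    suc ∣ A ∣ * degree F y
      ≡⟨ cong (λ a → a * degree F y) cardinality ⟨
    countTrue (λ x → does (y ≟ x) ∨ x ∈ᵇ A) * degree F y
      ≤⟨ countTrue*≤sumFin _ (degree F) (degree F y) heavy ⟩
    sumFin (degree F)
      ≡⟨ sumFin-degree F ⟩
    2 * edgeCount F ∎
    where
    open ≤-Reasoning
    disjoint : ∀ x → does (y ≟ x) ≡ true → x ∈ᵇ A ≡ false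
    disjoint x y≡x with y ≟ x
    ... | yes refl = y∉A
    cardinality : countTrue (λ x → does (y ≟ x) ∨ x ∈ᵇ A) ≡ suc ∣ A ∣
    cardinality = trans (countTrue-∨-disjoint _ (_∈ᵇ A) disjoint)
                        (cong₂ _+_ (countTrue-≟ y) (sym (∣A∣≡countTrue A)))
    heavy : ∀ x → does (y ≟ x) ∨ x ∈ᵇ A ≡ true → degree F y ≤ degree F x
    heavy x y∨A with y ≟ x
    ... | yes refl = ≤-refl
    ... | no _     = top x y∨A

  majority : ∀ l h e {N} .{{_ : NonZero N}} → l + h ≡ N →
             h * suc (2 * (2 * e)) ≤ 2 * e * N → N < 2 * l
  majority l h e {N} split bound with h <? l
  ... | yes h<l = begin-strict
    N      ≡⟨ split ⟨
    l + h  <⟨ +-monoʳ-< l h<l ⟩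
    l + l  ≡⟨ cong (l +_) (+-identityʳ l) ⟨
    2 * l  ∎
    where open ≤-Reasoning
  ... | no h≮l = contradiction (trans (sym split) (cong₂ _+_ l≡0 h≡0)) (≢-nonZero⁻¹ N)
    where
    open ≤-Reasoning
    l≤h : l ≤ h
    l≤h = ≮⇒≥ h≮l
    h≡0 : h ≡ 0
    h≡0 = n≤0⇒n≡0 (+-cancelʳ-≤ (h * (2 * (2 * e))) h 0 (begin
      h + h * (2 * (2 * e))  ≡⟨ *-suc h (2 * (2 * e)) ⟨
      h * suc (2 * (2 * e))  ≤⟨ bound ⟩
      2 * e * N              ≡⟨ cong (2 * e *_) split ⟨
      2 * e * (l + h)        ≤⟨ *-monoʳ-≤ (2 * e) (+-monoˡ-≤ h l≤h) ⟩
      2 * e * (h + h)        ≡⟨ double e h ⟩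
      h * (2 * (2 * e))      ∎))
      where
      double : ∀ e h → 2 * e * (h + h) ≡ h * (2 * (2 * e))
      double = solve-∀
    l≡0 : l ≡ 0
    l≡0 = n≤0⇒n≡0 (subst (l ≤_) h≡0 l≤h)

  -- Markov's inequality; deg v · N ≤ 2 · 2e says that deg v is at most twice the average degree 2e/N.
  more-than-half-low-degree : (G : Graph) .{{_ : NonZero (size G)}} →
    size G < 2 * countTrue (λ v → degree G v * size G ≤ᵇ 2 * (2 * edgeCount G))
  more-than-half-low-degree G = majority _ (countTrue (not ∘ low)) (edgeCount G) (countTrue-not low) (begin
    countTrue (not ∘ low) * suc (2 * (2 * edgeCount G))  ≤⟨ countTrue*≤sumFin _ _ _ heavy ⟩
    sumFin (λ v → degree G v * size G)                    ≡⟨ sumFin-*ʳ (degree G) (size G) ⟩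
    sumFin (degree G) * size G                            ≡⟨ cong (_* size G) (sumFin-degree G) ⟩
    2 * edgeCount G * size G                              ∎)
    where
    open ≤-Reasoning
    low : V G → Bool
    low v = degree G v * size G ≤ᵇ 2 * (2 * edgeCount G)
    heavy : ∀ v → not (low v) ≡ true → suc (2 * (2 * edgeCount G)) ≤ degree G v * size G
    heavy v high with low v | ≤ᵇ-reflects-≤ (degree G v * size G) (2 * (2 * edgeCount G))
    ... | false | ofⁿ ≰ = ≰⇒> ≰

  room-for-vertex : ∀ k t m D n N → suc k * t ≤ 2 * m → 4 * m * D + 2 * n * suc k ≤ N * suc k →
                    2 * (n + t * D) ≤ N
  room-for-vertex k t m D n N kt≤2m room = *-cancelʳ-≤ (2 * (n + t * D)) N (suc k) (begin
    2 * (n + t * D) * suc k              ≡⟨ expand n t D k ⟩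
    2 * n * suc k + suc k * t * (2 * D)  ≤⟨ +-monoʳ-≤ (2 * n * suc k) (*-monoˡ-≤ (2 * D) kt≤2m) ⟩
    2 * n * suc k + 2 * m * (2 * D)      ≡⟨ regroup n k m D ⟩
    4 * m * D + 2 * n * suc k            ≤⟨ room ⟩
    N * suc k                            ∎)
    where
    open ≤-Reasoning
    expand : ∀ n t D k → 2 * (n + t * D) * suc k ≡ 2 * n * suc k + suc k * t * (2 * D)
    expand = solve-∀
    regroup : ∀ n k m D → 2 * n * suc k + 2 * m * (2 * D) ≡ 4 * m * D + 2 * n * suc k
    regroup = solve-∀

  enough-hosts : (F G : Graph) .{{_ : NonZero (size G)}} (A : Subset (size F)) (D : ℕ) →
    (∀ x y → x ∈ᵇ A ≡ true → y ∈ᵇ A ≡ false → degree F y ≤ degree F x) →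
    2 * (2 * edgeCount G) / size G ≤ D →
    4 * edgeCount F * D + 2 * size F * suc ∣ A ∣ ≤ size G * suc ∣ A ∣ →
    ∀ y → y ∈ᵇ A ≡ false → size F + degree F y * D < countTrue (λ v → degree G v ≤ᵇ D)
  enough-hosts F G A D top average≤D room y y∉A = *-cancelˡ-< 2 _ _ (begin-strict
    2 * (size F + degree F y * D)
      ≤⟨ room-for-vertex ∣ A ∣ (degree F y) (edgeCount F) D (size F) (size G)
                         (degree-below-top F A y y∉A (λ x x∈A → top x y x∈A y∉A)) room ⟩
    size G
      <⟨ more-than-half-low-degree G ⟩
    2 * countTrue (λ v → degree G v * size G ≤ᵇ 2 * (2 * edgeCount G))
      ≤⟨ *-monoʳ-≤ 2 (countTrue-mono low⇒bounded) ⟩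
    2 * countTrue (λ v → degree G v ≤ᵇ D) ∎)
    where
    open ≤-Reasoning
    low⇒bounded : ∀ v → (degree G v * size G ≤ᵇ 2 * (2 * edgeCount G)) ≡ true → (degree G v ≤ᵇ D) ≡ true
    low⇒bounded v low = Equivalence.to T-≡ (≤⇒≤ᵇ (begin
      degree G v                                ≡⟨ m*n/n≡m (degree G v) (size G) ⟨
      degree G v * size G / size G              ≤⟨ /-monoˡ-≤ (size G) (≤ᵇ⇒≤ _ _ (Equivalence.from T-≡ low)) ⟩
      2 * (2 * edgeCount G) / size G            ≤⟨ average≤D ⟩
      D                                         ∎))

module RationalBound where

  open import Data.Integer as ℤ using (+_)
  import Data.Integer.Properties as ℤ
  open import Data.Nat as ℕ using (ℕ; suc; NonZero)
  import Data.Nat.Properties as ℕ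
  import Data.Nat.DivMod as DivMod
  open import Data.Nat.Tactic.RingSolver using (solve-∀)
  open import Data.Rational using (_/_; _⊔_; _+_; _*_; _≤_; toℚᵘ)
  import Data.Rational.Properties as ℚ
  open import Data.Rational.Unnormalised as ℚᵘ using (mkℚᵘ; *≤*) renaming (_≤_ to _≤ᵘ_; _≃_ to _≃ᵘ_)
  import Data.Rational.Unnormalised.Properties as ℚᵘ
  open import Data.Sum using (inj₁; inj₂)
  open import Relation.Binary.PropositionalEquality

  toℚᵘ-/ : ∀ p k → toℚᵘ (+ p / suc k) ≃ᵘ mkℚᵘ (+ p) k
  toℚᵘ-/ p k = ℚ.toℚᵘ-fromℚᵘ (mkℚᵘ (+ p) k)

  clear-denominator : ∀ a k D c N → (+ a / suc k) * ℕ→ℚ D + ℕ→ℚ c ≤ ℕ→ℚ N →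
                      a ℕ.* D ℕ.+ c ℕ.* suc k ℕ.≤ N ℕ.* suc k
  clear-denominator a k D c N le = subst₂ ℕ._≤_ lhs-nf rhs-nf (cross-multiplied unnormalised)
    where
    lhs : toℚᵘ ((+ a / suc k) * ℕ→ℚ D + ℕ→ℚ c) ≃ᵘ mkℚᵘ (+ a) k ℚᵘ.* mkℚᵘ (+ D) 0 ℚᵘ.+ mkℚᵘ (+ c) 0
    lhs = ℚᵘ.≃-trans (ℚ.toℚᵘ-homo-+ ((+ a / suc k) * ℕ→ℚ D) (ℕ→ℚ c))
            (ℚᵘ.+-cong (ℚᵘ.≃-trans (ℚ.toℚᵘ-homo-* (+ a / suc k) (ℕ→ℚ D))
                                   (ℚᵘ.*-cong (toℚᵘ-/ a k) (toℚᵘ-/ D 0)))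
                       (toℚᵘ-/ c 0))
    unnormalised : mkℚᵘ (+ a) k ℚᵘ.* mkℚᵘ (+ D) 0 ℚᵘ.+ mkℚᵘ (+ c) 0 ≤ᵘ mkℚᵘ (+ N) 0
    unnormalised = ℚᵘ.≤-respʳ-≃ (toℚᵘ-/ N 0) (ℚᵘ.≤-respˡ-≃ lhs (ℚ.toℚᵘ-mono-≤ le))
    cross-multiplied : mkℚᵘ (+ a) k ℚᵘ.* mkℚᵘ (+ D) 0 ℚᵘ.+ mkℚᵘ (+ c) 0 ≤ᵘ mkℚᵘ (+ N) 0 →
                       (a ℕ.* D ℕ.* 1 ℕ.+ c ℕ.* suc (k ℕ.* 1)) ℕ.* 1 ℕ.≤ N ℕ.* suc (k ℕ.* 1 ℕ.* 1)
    -- ℤ multiplication of + m and + n computes to + ◃ (m * n); +◃n≡+n turns it back into + (m * n).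
    cross-multiplied (*≤* le′)
      rewrite ℤ.+◃n≡+n (a ℕ.* D) | ℤ.+◃n≡+n (c ℕ.* suc (k ℕ.* 1)) | ℤ.+◃n≡+n (a ℕ.* D ℕ.* 1)
            | ℤ.+◃n≡+n ((a ℕ.* D ℕ.* 1 ℕ.+ c ℕ.* suc (k ℕ.* 1)) ℕ.* 1)
            | ℤ.+◃n≡+n (N ℕ.* suc (k ℕ.* 1 ℕ.* 1)) = ℤ.drop‿+≤+ le′
    lhs-nf : (a ℕ.* D ℕ.* 1 ℕ.+ c ℕ.* suc (k ℕ.* 1)) ℕ.* 1 ≡ a ℕ.* D ℕ.+ c ℕ.* suc k
    lhs-nf = drop-ones a D c k
      where
      drop-ones : ∀ a D c k → (a ℕ.* D ℕ.* 1 ℕ.+ c ℕ.* suc (k ℕ.* 1)) ℕ.* 1 ≡ a ℕ.* D ℕ.+ c ℕ.* suc k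
      drop-ones = solve-∀
    rhs-nf : N ℕ.* suc (k ℕ.* 1 ℕ.* 1) ≡ N ℕ.* suc k
    rhs-nf = cong (λ j → N ℕ.* suc j) (trans (ℕ.*-identityʳ (k ℕ.* 1)) (ℕ.*-identityʳ k))

  *≤⇒≤-/ : ∀ L p q N → L ℕ.* suc N ℕ.≤ p ℕ.* q → ℕ→ℚ L ≤ ℕ→ℚ p * (+ q / suc N)
  *≤⇒≤-/ L p q N le =
    ℚ.toℚᵘ-cancel-≤ (ℚᵘ.≤-respʳ-≃ (ℚᵘ.≃-sym rhs) (ℚᵘ.≤-respˡ-≃ (ℚᵘ.≃-sym (toℚᵘ-/ L 0)) cross))
    where
    rhs : toℚᵘ (ℕ→ℚ p * (+ q / suc N)) ≃ᵘ mkℚᵘ (+ p) 0 ℚᵘ.* mkℚᵘ (+ q) N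
    rhs = ℚᵘ.≃-trans (ℚ.toℚᵘ-homo-* (ℕ→ℚ p) (+ q / suc N)) (ℚᵘ.*-cong (toℚᵘ-/ p 0) (toℚᵘ-/ q N))
    cross : mkℚᵘ (+ L) 0 ≤ᵘ mkℚᵘ (+ p) 0 ℚᵘ.* mkℚᵘ (+ q) N
    cross = *≤* (subst₂ ℤ._≤_ (ℤ.pos-* L (suc (N ℕ.+ 0)))
                              (trans (ℤ.pos-* (p ℕ.* q) 1) (cong (ℤ._* + 1) (ℤ.pos-* p q)))
                              (ℤ.+≤+ le′))
      where
      le′ : L ℕ.* suc (N ℕ.+ 0) ℕ.≤ p ℕ.* q ℕ.* 1
      le′ = subst₂ ℕ._≤_ (cong (λ j → L ℕ.* suc j) (sym (ℕ.+-identityʳ N)))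
                         (sym (ℕ.*-identityʳ (p ℕ.* q))) le

  ℕ→ℚ-⊔-≤ : ∀ a b {q} → ℕ→ℚ b ≤ q → ℕ→ℚ (a ℕ.⊔ b) ≤ ℕ→ℚ a ⊔ q
  ℕ→ℚ-⊔-≤ a b b≤q with ℕ.≤-total a b
  ... | inj₁ a≤b rewrite ℕ.m≤n⇒m⊔n≡n a≤b = ℚ.p≤q⇒p≤r⊔q (ℕ→ℚ a) b≤q
  ... | inj₂ b≤a rewrite ℕ.m≥n⇒m⊔n≡m b≤a = ℚ.p≤p⊔q (ℕ→ℚ a) _

  -- Twice the average degree, 2 · (2e/N), is replaced by the integer ⌊4e/N⌋ below it.
  hypothesis-in-ℕ : ∀ N k m n Δ e .{{_ : NonZero N}} →
    (+ (4 ℕ.* m) / suc k) * (ℕ→ℚ Δ ⊔ (ℕ→ℚ 2 * (+ (2 ℕ.* e) / N))) + ℕ→ℚ (2 ℕ.* n) ≤ ℕ→ℚ N →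
    4 ℕ.* m ℕ.* (Δ ℕ.⊔ 2 ℕ.* (2 ℕ.* e) ℕ./ N) ℕ.+ 2 ℕ.* n ℕ.* suc k ℕ.≤ N ℕ.* suc k
  hypothesis-in-ℕ (suc N) k m n Δ e hyp =
    clear-denominator (4 ℕ.* m) k (Δ ℕ.⊔ L) (2 ℕ.* n) (suc N)
      (ℚ.≤-trans (ℚ.+-monoˡ-≤ (ℕ→ℚ (2 ℕ.* n))
                    (ℚ.*-monoˡ-≤-nonNeg (+ (4 ℕ.* m) / suc k) {{ℚ.normalize-nonNeg (4 ℕ.* m) (suc k)}}
                       (ℕ→ℚ-⊔-≤ Δ L
                          (*≤⇒≤-/ L 2 (2 ℕ.* e) N (DivMod.m/n*n≤m (2 ℕ.* (2 ℕ.* e)) (suc N))))))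
                 hyp)
    where
    L : ℕ
    L = 2 ℕ.* (2 ℕ.* e) ℕ./ suc N

module GreedyEmbedding (F G : Graph) (D : ℕ) where

  open import Data.Bool using (Bool; true; false; _∧_; _∨_)
  open import Data.Bool.Properties using (∨-conicalˡ; ∨-conicalʳ; T-≡)
  open import Function.Bundles using (Equivalence)
  open import Data.Fin using (toℕ; fromℕ<; _≟_)
  open import Data.Fin.Properties using (toℕ-fromℕ<; toℕ<n; toℕ-injective)
  open import Data.Nat using (ℕ; zero; suc; _+_; _*_; _≤_; _<_; _<ᵇ_; _≤ᵇ_; z≤n)
  open import Data.Nat.Properties hiding (_≟_)
  open import Data.Product using (Σ; _×_; _,_)
  open import Data.Sum using (_⊎_; inj₁; inj₂)
  open import Data.Vec.Functional using (updateAt)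
  open import Data.Vec.Functional.Properties using (updateAt-updates; updateAt-minimal)
  open import Function using (_∘_; const)
  open import Relation.Binary.PropositionalEquality
  open import Relation.Nullary using (does; yes; no; contradiction)
  open import Relation.Nullary.Decidable using (dec-true)
  open import Relation.Nullary.Reflects using (ofʸ; ofⁿ)
  open FiniteSums

  _⊆_ : (V F → Bool) → (V F → Bool) → Set
  S ⊆ T = ∀ x → S x ≡ true → T x ≡ true

  _∪⁅_⁆ : (V F → Bool) → V F → V F → Bool
  (S ∪⁅ y ⁆) x = does (y ≟ x) ∨ S x

  EmbedsOn-⊆ : ∀ {S T σ} → T ⊆ S → EmbedsOn F G S σ → EmbedsOn F G T σ
  EmbedsOn-⊆ T⊆S (injective , nonadjacent) =
    (λ x x′ Tx Tx′ → injective x x′ (T⊆S x Tx) (T⊆S x′ Tx′)) ,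
    (λ x x′ Tx Tx′ → nonadjacent x x′ (T⊆S x Tx) (T⊆S x′ Tx′))

  Bounded : (V F → Bool) → (V F → V G) → Set
  Bounded S σ = ∀ x → S x ≡ true → degree G (σ x) ≤ D

  record IsHost (S : V F → Bool) (σ : V F → V G) (y : V F) (c : V G) : Set where
    field
      unused      : ∀ x → S x ≡ true → σ x ≢ c
      nonadjacent : ∀ x → S x ≡ true → adj F y x ≡ true → adj G (σ x) c ≡ false
      bounded     : degree G c ≤ D

  host-exists : (S : V F → Bool) (σ : V F → V G) (y : V F) → Bounded S σ →
                size F + degree F y * D < countTrue (λ v → degree G v ≤ᵇ D) →
                Σ (V G) (IsHost S σ y)
  host-exists S σ y bounded room
    with ∃-avoiding (λ v → degree G v ≤ᵇ D) conflict (≤-<-trans conflicts room)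
    where
    conflict : V F → V G → Bool
    conflict x v = S x ∧ (does (σ x ≟ v) ∨ (adj F y x ∧ adj G (σ x) v))
    neighbours : ∀ x → S x ≡ true → countTrue (λ v → adj F y x ∧ adj G (σ x) v) ≤ indicator (adj F y x) * D
    neighbours x Sx with adj F y x
    ... | false = ≤-reflexive (countTrue-false {size G})
    ... | true  = ≤-trans (bounded x Sx) (≤-reflexive (sym (+-identityʳ D)))
    conflicts-of : ∀ x → countTrue (conflict x) ≤ 1 + indicator (adj F y x) * D
    conflicts-of x with S x in Sx
    ... | false = ≤-trans (≤-reflexive (countTrue-false {size G})) z≤n
    ... | true  = ≤-trans (countTrue-∨ (λ v → does (σ x ≟ v)) (λ v → adj F y x ∧ adj G (σ x) v))
                          (+-mono-≤ (≤-reflexive (countTrue-≟ (σ x))) (neighbours x Sx))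
    conflicts : sumFin (λ x → countTrue (conflict x)) ≤ size F + degree F y * D
    conflicts = begin
      sumFin (λ x → countTrue (conflict x))
        ≤⟨ sumFin-mono-≤ conflicts-of ⟩
      sumFin (λ x → 1 + indicator (adj F y x) * D)
        ≡⟨ sumFin-+ (const 1) (λ x → indicator (adj F y x) * D) ⟩
      sumFin {size F} (const 1) + sumFin (λ x → indicator (adj F y x) * D)
        ≡⟨ cong₂ _+_ (trans (sumFin-const {size F} 1) (*-identityʳ (size F)))
                     (sumFin-*ʳ (indicator ∘ adj F y) D) ⟩
      size F + sumFin (indicator ∘ adj F y) * D
        ≡⟨ cong (λ d → size F + d * D) (countTrue≡sumFin (adj F y)) ⟨
      size F + degree F y * D ∎
      where open ≤-Reasoning
  ... | c , low , free = c , record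
    { unused      = λ x Sx σx≡c →
        contradiction (trans (sym (dec-true (σ x ≟ c) σx≡c)) (∨-conicalˡ _ _ (allowed x Sx))) λ ()
    ; nonadjacent = λ x Sx y∼x → subst (λ b → b ∧ adj G (σ x) c ≡ false) y∼x (∨-conicalʳ _ _ (allowed x Sx))
    ; bounded     = ≤ᵇ⇒≤ (degree G c) D (Equivalence.from T-≡ low)
    }
    where
    allowed : ∀ x → S x ≡ true → does (σ x ≟ c) ∨ (adj F y x ∧ adj G (σ x) c) ≡ false
    allowed x Sx = subst (λ b → b ∧ _ ≡ false) Sx (free x)

  IsHost⇒extends : ∀ {S σ y c} → IsHost S σ y c → EmbedsOn F G S σ → Bounded S σ →
                   EmbedsOn F G (S ∪⁅ y ⁆) (updateAt σ y (const c)) ×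
                   Bounded (S ∪⁅ y ⁆) (updateAt σ y (const c))
  IsHost⇒extends {S} {σ} {y} {c} host (injective , nonadjacent) bounded =
    (injective′ , nonadjacent′) , bounded′
    where
    module H = IsHost host
    τ : V F → V G
    τ = updateAt σ y (const c)
    τy≡c : τ y ≡ c
    τy≡c = updateAt-updates y σ
    classify : ∀ x → (S ∪⁅ y ⁆) x ≡ true → x ≡ y ⊎ (S x ≡ true × τ x ≡ σ x)
    classify x Sx with y ≟ x
    ... | yes refl = inj₁ refl
    ... | no y≢x   = inj₂ (Sx , updateAt-minimal x y σ (y≢x ∘ sym))
    injective′ : ∀ x x′ → (S ∪⁅ y ⁆) x ≡ true → (S ∪⁅ y ⁆) x′ ≡ true → τ x ≡ τ x′ → x ≡ x′
    injective′ x x′ Sx Sx′ τx≡τx′ with classify x Sx | classify x′ Sx′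
    ... | inj₁ refl         | inj₁ refl           = refl
    ... | inj₁ refl         | inj₂ (Sx′ , τx′≡σx′) =
      contradiction (trans (sym τx′≡σx′) (trans (sym τx≡τx′) τy≡c)) (H.unused x′ Sx′)
    ... | inj₂ (Sx , τx≡σx) | inj₁ refl           =
      contradiction (trans (sym τx≡σx) (trans τx≡τx′ τy≡c)) (H.unused x Sx)
    ... | inj₂ (Sx , τx≡σx) | inj₂ (Sx′ , τx′≡σx′) =
      injective x x′ Sx Sx′ (trans (sym τx≡σx) (trans τx≡τx′ τx′≡σx′))
    nonadjacent′ : ∀ x x′ → (S ∪⁅ y ⁆) x ≡ true → (S ∪⁅ y ⁆) x′ ≡ true →
                   adj F x x′ ≡ true → adj G (τ x) (τ x′) ≡ false
    nonadjacent′ x x′ Sx Sx′ x∼x′ with classify x Sx | classify x′ Sx′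
    ... | inj₁ refl         | inj₁ refl           = contradiction (trans (sym (irrefl F y)) x∼x′) λ ()
    ... | inj₁ refl         | inj₂ (Sx′ , τx′≡σx′) =
      trans (cong₂ (adj G) τy≡c τx′≡σx′) (trans (Graph.sym G c (σ x′)) (H.nonadjacent x′ Sx′ x∼x′))
    ... | inj₂ (Sx , τx≡σx) | inj₁ refl           =
      trans (cong₂ (adj G) τx≡σx τy≡c) (H.nonadjacent x Sx (trans (Graph.sym F y x) x∼x′))
    ... | inj₂ (Sx , τx≡σx) | inj₂ (Sx′ , τx′≡σx′) =
      trans (cong₂ (adj G) τx≡σx τx′≡σx′) (nonadjacent x x′ Sx Sx′ x∼x′)
    bounded′ : Bounded (S ∪⁅ y ⁆) τ
    bounded′ x Sx with classify x Sx
    ... | inj₁ refl          = subst (λ v → degree G v ≤ D) (sym τy≡c) H.bounded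
    ... | inj₂ (Sx′ , τx≡σx) = subst (λ v → degree G v ≤ D) (sym τx≡σx) (bounded x Sx′)

  module _ (S : V F → Bool) (σ : V F → V G)
           (room : ∀ y → S y ≡ false → size F + degree F y * D < countTrue (λ v → degree G v ≤ᵇ D))
           where

    record Extends (T : V F → Bool) (τ : V F → V G) : Set where
      field
        agrees  : ∀ x → S x ≡ true → τ x ≡ σ x
        embeds  : EmbedsOn F G T τ
        bounded : Bounded T τ

    Extends-⊆ : ∀ {T U τ} → U ⊆ T → Extends T τ → Extends U τ
    Extends-⊆ U⊆T ext = record
      { agrees  = agrees
      ; embeds  = EmbedsOn-⊆ U⊆T embeds
      ; bounded = λ x Ux → bounded x (U⊆T x Ux)
      }
      where open Extends ext

    grow : ∀ {T τ} (y : V F) → S ⊆ T → Extends T τ → Σ (V F → V G) (Extends (T ∪⁅ y ⁆))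
    grow {T} {τ} y S⊆T ext with S y in Sy
    ... | true = τ , Extends-⊆ y∈T ext
      where
      y∈T : (T ∪⁅ y ⁆) ⊆ T
      y∈T x Tx with y ≟ x
      ... | yes refl = S⊆T y Sy
      ... | no _     = Tx
    ... | false with host-exists T τ y (Extends.bounded ext) (room y Sy)
    ...   | c , host =
      let embeds , bounded = IsHost⇒extends host (Extends.embeds ext) (Extends.bounded ext) in
      updateAt τ y (const c) , record
        { agrees  = λ x Sx → trans (updateAt-minimal x y τ (λ { refl → contradiction (trans (sym Sy) Sx) λ () }))
                                   (Extends.agrees ext x Sx)
        ; embeds  = embeds
        ; bounded = bounded
        }

    prefix : ℕ → V F → Bool
    prefix j x = S x ∨ (toℕ x <ᵇ j)

    S⊆prefix : ∀ j → S ⊆ prefix j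
    S⊆prefix j x Sx rewrite Sx = refl

    prefix-zero : prefix 0 ⊆ S
    prefix-zero x p with S x | toℕ x <ᵇ 0 | <ᵇ-reflects-< (toℕ x) 0
    ... | true  | _     | _      = refl
    ... | false | true  | ofʸ ()

    prefix-suc : ∀ {j} (j<n : j < size F) → prefix (suc j) ⊆ (prefix j ∪⁅ fromℕ< j<n ⁆)
    prefix-suc {j} j<n x p with fromℕ< j<n ≟ x
    ... | yes _    = refl
    ... | no y≢x with S x
    ...   | true  = refl
    ...   | false with toℕ x <ᵇ j | <ᵇ-reflects-< (toℕ x) j
    ...     | true  | _       = refl
    ...     | false | ofⁿ x≮j = contradiction (toℕ-injective (trans (toℕ-fromℕ< j<n) (sym x≡j))) y≢x
      where
      x≡j : toℕ x ≡ j
      x≡j = ≤-antisym (m<1+n⇒m≤n (<ᵇ⇒< (toℕ x) (suc j) (Equivalence.from T-≡ p))) (≮⇒≥ x≮j)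

    prefix-full : (λ _ → true) ⊆ prefix (size F)
    prefix-full x _ with S x
    ... | true  = refl
    ... | false = Equivalence.to T-≡ (<⇒<ᵇ (toℕ<n x))

    extend-prefix : Extends S σ → ∀ j → j ≤ size F → Σ (V F → V G) (Extends (prefix j))
    extend-prefix base zero    _   = σ , Extends-⊆ prefix-zero base
    extend-prefix base (suc j) j<n with extend-prefix base j (<⇒≤ j<n)
    ... | τ , ext with grow (fromℕ< j<n) (S⊆prefix j) ext
    ...   | τ′ , ext′ = τ′ , Extends-⊆ (prefix-suc j<n) ext′

  greedy-embedding : (S : V F → Bool) (σ : V F → V G) → EmbedsOn F G S σ → Bounded S σ →
                     (∀ y → S y ≡ false → size F + degree F y * D < countTrue (λ v → degree G v ≤ᵇ D)) →
                     Σ (V F → V G) λ τ → Embedding F G τ × (∀ x → S x ≡ true → τ x ≡ σ x)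
  greedy-embedding S σ embeds bounded room
    with extend-prefix S σ room (record { agrees = λ _ _ → refl ; embeds = embeds ; bounded = bounded })
                       (size F) ≤-refl
  ... | τ , ext = τ , EmbedsOn-⊆ (prefix-full S σ room) (Extends.embeds ext) , Extends.agrees ext

open import Data.Nat using (ℕ; suc; _≤_; NonZero; _*_)
open import Data.Bool using (true; false; if_then_else_)
open import Data.Fin.Subset using (Subset; ∣_∣)
open import Data.Integer using (+_)
open import Data.Rational using (_/_; _⊔_; _+_; _≥_) renaming (_*_ to _*ℚ_)
open import Data.Product using (Σ; _×_)
open import Relation.Binary.PropositionalEquality using (_≡_; refl; cong; subst)
import Data.Nat as ℕ
open import Data.Nat.Properties using (≤-trans; m≤m⊔n; m≤n⊔m)
open FiniteSums using (f≤maxFin)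
open Degrees using (enough-hosts)
open RationalBound using (hypothesis-in-ℕ)

lemma2p3 : (F G : Graph) → .{{_ : NonZero (size G)}} → (k : ℕ) → k ≤ size F
    → (A : Subset (size F)) → ∣ A ∣ ≡ k
    → (∀ x y → x ∈ᵇ A ≡ true → y ∈ᵇ A ≡ false → degree F y ≤ degree F x)
    → (σ' : V F → V G) → EmbedsOn F G (_∈ᵇ A) σ'
    → ℕ→ℚ (size G) ≥ (+ (4 * edgeCount F) / suc k)
                      *ℚ (ℕ→ℚ (maxFin (λ x → if x ∈ᵇ A then degree G (σ' x) else 0))
                          ⊔ (ℕ→ℚ 2 *ℚ avgDegree G))
                      + ℕ→ℚ (2 * size F)
    → Σ (V F → V G) (λ σ → Embedding F G σ × (∀ x → x ∈ᵇ A ≡ true → σ x ≡ σ' x))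
-- The hypothesis k ≤ size F is implied by ∣ A ∣ ≡ k.
lemma2p3 F G k _ A refl top σ' embeds hyp =
  greedy-embedding (_∈ᵇ A) σ' embeds bounded
    (enough-hosts F G A D top (m≤n⊔m Δ _)
       (hypothesis-in-ℕ (size G) ∣ A ∣ (edgeCount F) (size F) Δ (edgeCount G) hyp))
  where
  image-degree : V F → ℕ
  image-degree x = if x ∈ᵇ A then degree G (σ' x) else 0
  Δ : ℕ
  Δ = maxFin image-degree
  D : ℕ
  D = Δ ℕ.⊔ 2 * (2 * edgeCount G) ℕ./ size G
  open GreedyEmbedding F G D using (greedy-embedding)
  bounded : ∀ x → x ∈ᵇ A ≡ true → degree G (σ' x) ≤ D
  bounded x x∈A =
    ≤-trans (subst (_≤ Δ) (cong (λ b → if b then degree G (σ' x) else 0) x∈A) (f≤maxFin image-degree x))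
            (m≤m⊔n Δ _)
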